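{- Let $\varepsilon > 0$ and an integer $k \geq 4$ be fixed. If $k \geq 5$, let $C$ be an orientation of a $k$-cycle containing the oriented path $w_1\rightarrow w_2\leftarrow w_3\rightarrow w_4\leftarrow w_5$ as a subdigraph; if $k=4$, let $C$ be the orientation of a $4$-cycle obtained from the oriented path $w_1\rightarrow w_2\leftarrow w_3\rightarrow w_4\leftarrow w_5$ by identifying $w_1$ and $w_5$. Let $D$ be a digraph with $|V(D)| \geq 12/\varepsilon^2$, $\chi(D) \geq 4c^*_{k-1}/\varepsilon$ and minimum out-degree at least $\varepsilon |V(D)|$. Then $D$ contains a subdigraph isomorphic to $C$.
   Context: Digraphs have no loops and no parallel arcs (anti-parallel arcs allowed); $\chi(D)$ is the chromatic number of the underlying undirected graph; subdigraphs need not be induced. For an integer $j>0$, $c^*_j$ denotes the least integer such that every orientation of every graph $G$ with $\chi(G)\ge c^*_j$ contains every oriented tree on $j$ vertices as a subdigraph (this is finite by a theorem of Burr).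
   Formalization: The parameter ε ranges over the positive rationals. -}

module Defs where

open import Data.Nat as ℕ using (ℕ; zero; suc)
open import Data.Integer using (+_)
open import Data.Rational as ℚ using (ℚ; Positive; _÷_; _/_)
open import Data.Rational.Properties using (pos⇒nonZero)
open import Data.Fin using (Fin; zero; suc; toℕ; inject₁; fromℕ)
open import Data.Bool using (Bool; true; false; if_then_else_)
open import Data.List using (map; allFin)
open import Data.Nat.ListAction using (sum)
open import Data.Product using (Σ; _×_; _,_)
open import Data.Sum using (_⊎_)
open import Relation.Binary.PropositionalEquality using (_≡_; _≢_; refl)
open import Relation.Nullary using (¬_)

-- Finite digraphs on vertex set Fin n: no loops, no parallel arcs
-- (a Bool adjacency relation), anti-parallel arcs allowed.

record Digraph (n : ℕ) : Set where
  field
    arc      : Fin n → Fin n → Bool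
    loopless : ∀ v → arc v v ≡ false
open Digraph public

Arc : ∀ {n} → Digraph n → Fin n → Fin n → Set
Arc D u v = arc D u v ≡ true

Adj : ∀ {n} → Digraph n → Fin n → Fin n → Set
Adj D u v = Arc D u v ⊎ Arc D v u

-- oriented graph = orientation of an (undirected simple) graph:
-- no anti-parallel arcs
Oriented : ∀ {n} → Digraph n → Set
Oriented D = ∀ u v → Arc D u v → ¬ Arc D v u

Colourable : ∀ {n} → Digraph n → ℕ → Set
Colourable {n} D m = Σ (Fin n → Fin m) λ f → ∀ u v → Arc D u v → f u ≢ f v

ChiAtLeastℕ : ∀ {n} → Digraph n → ℕ → Set
ChiAtLeastℕ D c = ∀ m → Colourable D m → c ℕ.≤ m

ChiAtLeast : ∀ {n} → Digraph n → ℚ → Set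
ChiAtLeast D t = ∀ m → Colourable D m → t ℚ.≤ (+ m / 1)

Contains : ∀ {n h} → Digraph n → Digraph h → Set
Contains {n} {h} D H =
  Σ (Fin h → Fin n) λ φ →
    (∀ a b → φ a ≡ φ b → a ≡ b) × (∀ a b → Arc H a b → Arc D (φ a) (φ b))

data Walk {n} (D : Digraph n) : Fin n → Fin n → Set where
  here : ∀ {v} → Walk D v v
  step : ∀ {u w v} → Adj D u w → Walk D w v → Walk D u v

Connected : ∀ {n} → Digraph n → Set
Connected D = ∀ u v → Walk D u v

HasCycle : ∀ {n} → Digraph n → Set
HasCycle {n} D =
  Σ ℕ λ r → Σ (Fin (3 ℕ.+ r) → Fin n) λ g →
    (∀ i j → g i ≡ g j → i ≡ j)
    × (∀ (i : Fin (2 ℕ.+ r)) → Adj D (g (inject₁ i)) (g (suc i)))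
    × Adj D (g (fromℕ (2 ℕ.+ r))) (g zero)

IsTree : ∀ {n} → Digraph n → Set
IsTree D = Connected D × ¬ HasCycle D

OrientedTree : ∀ {n} → Digraph n → Set
OrientedTree T = Oriented T × IsTree T

CStarProperty : ℕ → ℕ → Set
CStarProperty j c =
  ∀ n (D : Digraph n) → Oriented D → ChiAtLeastℕ D c →
  ∀ (T : Digraph j) → OrientedTree T → Contains D T

IsCStar : ℕ → ℕ → Set
IsCStar j c = CStarProperty j c × (∀ c' → CStarProperty j c' → c ℕ.≤ c')

outdeg : ∀ {n} → Digraph n → Fin n → ℕ
outdeg {n} D v = sum (map (λ u → if arc D v u then 1 else 0) (allFin n))

CycSucc : ∀ k → Fin k → Fin k → Set
CycSucc k u v = suc (toℕ u) ≡ toℕ v ⊎ (suc (toℕ u) ≡ k × toℕ v ≡ 0)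

CycAdj : ∀ k → Fin k → Fin k → Set
CycAdj k u v = CycSucc k u v ⊎ CycSucc k v u

OrientedCycle : ∀ k → Digraph k → Set
OrientedCycle k C =
  Oriented C × (∀ u v → Adj C u v → CycAdj k u v) × (∀ u v → CycAdj k u v → Adj C u v)

-- The oriented path w1 → w2 ← w3 → w4 ← w5 (w_i = vertex i-1).

p5arc : Fin 5 → Fin 5 → Bool
p5arc zero (suc zero) = true
p5arc (suc (suc zero)) (suc zero) = true
p5arc (suc (suc zero)) (suc (suc (suc zero))) = true
p5arc (suc (suc (suc (suc zero)))) (suc (suc (suc zero))) = true
p5arc _ _ = false

P5 : Digraph 5
P5 = record { arc = p5arc ; loopless = lp }
  where
  lp : ∀ v → p5arc v v ≡ false
  lp zero = refl
  lp (suc zero) = refl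
  lp (suc (suc zero)) = refl
  lp (suc (suc (suc zero))) = refl
  lp (suc (suc (suc (suc zero)))) = refl

-- The 4-cycle obtained from P5 by identifying w1 and w5:
-- vertices w1(=w5), w2, w3, w4 ↦ 0,1,2,3; arcs 0→1, 2→1, 2→3, 0→3.
c4arc : Fin 4 → Fin 4 → Bool
c4arc zero (suc zero) = true
c4arc (suc (suc zero)) (suc zero) = true
c4arc (suc (suc zero)) (suc (suc (suc zero))) = true
c4arc zero (suc (suc (suc zero))) = true
c4arc _ _ = false

C4 : Digraph 4
C4 = record { arc = c4arc ; loopless = lp }
  where
  lp : ∀ v → c4arc v v ≡ false
  lp zero = refl
  lp (suc zero) = refl
  lp (suc (suc zero)) = refl
  lp (suc (suc (suc zero))) = refl

_÷⁺_ : (x ε : ℚ) → .{{Positive ε}} → ℚ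
(x ÷⁺ ε) {{p}} = (x ÷ ε) {{pos⇒nonZero ε {{p}}}}

ℕ→ℚ : ℕ → ℚ
ℕ→ℚ m = + m / 1

-- For a vertex x, let its wedge W(x) be the set of vertices outside {x} ∪ N⁺(x) having at
-- least two common out-neighbours with x, and let w₁ → w₂ ← w₃ → w₄ ← w₅ sit in C. Deleting w₃ from the
-- cycle C leaves an oriented tree on k - 1 vertices, so if D[N⁺(x)] or D[W(x)] has chromatic number at
-- least c = c*ₖ₋₁, it contains C - w₃. In N⁺(x) the copy closes up by sending w₃ to x; in W(x) one first
-- moves w₂ and w₄ to distinct common out-neighbours of x with the images of w₁ and w₅.
-- Otherwise every set {x} ∪ N⁺(x) ∪ W(x) is (2c - 1)-colourable. Pick vertices greedily, each outside
-- these sets of the earlier ones. If this stops after t ≤ 2/ε picks, the sets of the picked vertices cover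
-- D and χ(D) ≤ t (2c - 1) < 4c/ε. Otherwise s = ⌊2/ε⌋ + 1 picked vertices have out-neighbourhoods of
-- size at least εn that pairwise share at most one vertex, so n ≥ s εn - C(s, 2); as s ε > 2 this
-- forces n ≤ C(s, 2) < 12/ε².

module Submission where

open import Defs
open import Data.Nat using (ℕ; _≤_; _∸_; _*_)
open import Data.Rational using (ℚ; Positive) renaming (_≤_ to _≤ℚ_; _*_ to _*ℚ_)
open import Data.Product using (_×_)
open import Relation.Binary.PropositionalEquality using (_≡_)

open import Data.Bool using (Bool; true; false; not; _∧_; _∨_; if_then_else_; T)
import Data.Bool.Properties as Boolₚ
open import Data.Empty using (⊥; ⊥-elim)
open import Data.Fin as Fin using (Fin; zero; suc; toℕ)
import Data.Fin.Properties as Finₚ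
import Data.Fin.Relation.Unary.Top as Top
open import Data.Integer as ℤ using (+[1+_])
import Data.Integer.Properties as ℤₚ
open import Data.List using (List; allFin; tabulate; filter; lookup; length)
open import Data.List.Membership.Propositional.Properties using (∈-filter⁺; ∈-filter⁻; ∈-lookup; ∈-allFin)
import Data.List.Properties as Listₚ
import Data.List.Relation.Unary.All as All
import Data.List.Relation.Unary.AllPairs.Properties as AllPairs
import Data.List.Relation.Unary.Any as Any
open import Data.List.Relation.Unary.Any.Properties using (lookup-index)
open import Data.List.Relation.Unary.Unique.Propositional using (Unique; _∷_)
open import Data.List.Relation.Unary.Unique.Propositional.Properties using (allFin⁺)
open import Data.Nat as ℕ using (zero; suc; _+_; _<_; _/_; _%_; z≤n; s≤s; NonZero)
open import Data.Nat.Combinatorics renaming (_C_ to _choose_) using (nC1≡n; nCk+nC[k+1]≡[n+1]C[k+1])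
open import Data.Nat.Coprimality using (Coprime)
import Data.Nat.DivMod as DivMod
open import Data.Nat.ListAction using (sum)
import Data.Nat.Properties as ℕₚ
open import Algebra.Properties.CommutativeSemigroup ℕₚ.+-commutativeSemigroup using (interchange)
open import Data.Nat.Tactic.RingSolver using (solve-∀)
open import Data.Product using (∃; ∃₂; _,_; proj₁; proj₂)
open import Data.Rational using (mkℚ; toℚᵘ; _÷_; 1/_)
import Data.Rational.Properties as ℚₚ
open import Data.Rational.Unnormalised as ℚᵘ using (ℚᵘ; mkℚᵘ; *≤*) renaming (_≤_ to _≤ᵘ_; _≃_ to _≃ᵘ_)
import Data.Rational.Unnormalised.Properties as ℚᵘₚ
open import Data.Sum as Sum using (_⊎_; inj₁; inj₂; [_,_])
import Data.Vec.Functional as Vector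
open import Data.Vec.Functional using (updateAt)
open import Data.Vec.Functional.Properties using (updateAt-updates; updateAt-minimal)
open import Function using (_∘_; id; const; Equivalence)
open import Relation.Binary.Definitions using (tri<; tri≈; tri>)
open import Relation.Binary.PropositionalEquality
  using (_≢_; _≗_; refl; sym; trans; cong; cong₂; subst; subst₂; module ≡-Reasoning)
open import Relation.Nullary using (¬_; Dec; yes; no; does; contradiction; ¬?; _→-dec_; _×-dec_; _⊎-dec_)
open import Relation.Nullary.Decidable using (from-yes)

Arc-irrefl : ∀ {n} (D : Digraph n) u → ¬ Arc D u u
Arc-irrefl D u uu with trans (sym uu) (loopless D u)
... | ()

Arc⇒≢ : ∀ {n} (D : Digraph n) {u v} → Arc D u v → u ≢ v
Arc⇒≢ D {u} uv refl = Arc-irrefl D u uv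

∧-true : ∀ {a b} → a ∧ b ≡ true → a ≡ true × b ≡ true
∧-true {true} {true} refl = refl , refl

-- Counting

indicator : Bool → ℕ
indicator b = if b then 1 else 0

count : ∀ {n} → (Fin n → Bool) → ℕ
count {zero}  f = 0
count {suc n} f = indicator (f zero) + count (f ∘ suc)

outdeg≡count : ∀ {n} (D : Digraph n) v → outdeg D v ≡ count (arc D v)
outdeg≡count D v = trans (cong sum (Listₚ.map-tabulate id (indicator ∘ arc D v))) (sum-tabulate (arc D v))
  where
  sum-tabulate : ∀ {m} (f : Fin m → Bool) → sum (tabulate (indicator ∘ f)) ≡ count f
  sum-tabulate {zero}  f = refl
  sum-tabulate {suc m} f = cong (indicator (f zero) +_) (sum-tabulate (f ∘ suc))

count≤n : ∀ {n} (f : Fin n → Bool) → count f ≤ n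
count≤n {zero}  f = z≤n
count≤n {suc n} f with f zero
... | true  = s≤s (count≤n (f ∘ suc))
... | false = ℕₚ.m≤n⇒m≤1+n (count≤n (f ∘ suc))

count-cong : ∀ {n} {f g : Fin n → Bool} → f ≗ g → count f ≡ count g
count-cong {zero}  f≗g = refl
count-cong {suc n} f≗g = cong₂ _+_ (cong indicator (f≗g zero)) (count-cong (f≗g ∘ suc))

count-none : ∀ {n} (f : Fin n → Bool) → (∀ u → f u ≡ false) → count f ≡ 0
count-none {zero}  f none = refl
count-none {suc n} f none rewrite none zero = count-none (f ∘ suc) (none ∘ suc)

count-∨-∧ : ∀ {n} (f g : Fin n → Bool) →
            count f + count g ≡ count (λ u → f u ∨ g u) + count (λ u → f u ∧ g u)
count-∨-∧ {zero}  f g = refl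
count-∨-∧ {suc n} f g = begin
  (indicator a + count (f ∘ suc)) + (indicator b + count (g ∘ suc))
    ≡⟨ interchange (indicator a) _ (indicator b) _ ⟩
  (indicator a + indicator b) + (count (f ∘ suc) + count (g ∘ suc))
    ≡⟨ cong₂ _+_ (indicator-∨-∧ a b) (count-∨-∧ (f ∘ suc) (g ∘ suc)) ⟩
  (indicator (a ∨ b) + indicator (a ∧ b)) + (count (λ u → f′ u ∨ g′ u) + count (λ u → f′ u ∧ g′ u))
    ≡⟨ interchange (indicator (a ∨ b)) _ _ _ ⟩
  (indicator (a ∨ b) + count (λ u → f′ u ∨ g′ u)) + (indicator (a ∧ b) + count (λ u → f′ u ∧ g′ u)) ∎
  where
  open ≡-Reasoning
  a = f zero
  b = g zero
  f′ = f ∘ suc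
  g′ = g ∘ suc
  indicator-∨-∧ : ∀ a b → indicator a + indicator b ≡ indicator (a ∨ b) + indicator (a ∧ b)
  indicator-∨-∧ true  true  = refl
  indicator-∨-∧ true  false = refl
  indicator-∨-∧ false true  = refl
  indicator-∨-∧ false false = refl

count-∨≤ : ∀ {n} (f g : Fin n → Bool) → count (λ u → f u ∨ g u) ≤ count f + count g
count-∨≤ f g = subst (count (λ u → f u ∨ g u) ≤_) (sym (count-∨-∧ f g)) (ℕₚ.m≤m+n _ _)

count>0⇒∃ : ∀ {n} (f : Fin n → Bool) → 0 < count f → ∃ λ u → f u ≡ true
count>0⇒∃ {suc n} f pos with f zero in f₀
... | true  = zero , f₀
... | false = let (u , fu) = count>0⇒∃ (f ∘ suc) pos in suc u , fu

count>1⇒∃≢ : ∀ {n} (f : Fin n → Bool) → 1 < count f → ∀ y → ∃ λ u → u ≢ y × f u ≡ true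
count>1⇒∃≢ {suc n} f >1 zero with f zero
... | true  = let (u , fu) = count>0⇒∃ (f ∘ suc) (ℕₚ.≤-pred >1) in suc u , (λ ()) , fu
... | false = let (u , fu) = count>0⇒∃ (f ∘ suc) (ℕₚ.<-trans (s≤s z≤n) >1) in suc u , (λ ()) , fu
count>1⇒∃≢ {suc n} f >1 (suc y) with f zero in f₀
... | true  = zero , (λ ()) , f₀
... | false = let (u , u≢y , fu) = count>1⇒∃≢ (f ∘ suc) >1 y in suc u , u≢y ∘ Finₚ.suc-injective , fu

⋃ : ∀ {t n} → (Fin t → Fin n → Bool) → Fin n → Bool
⋃ {zero}  F u = false
⋃ {suc t} F u = F zero u ∨ ⋃ (F ∘ suc) u

count-∧-⋃≤ : ∀ {t n} (f : Fin n → Bool) (G : Fin t → Fin n → Bool) →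
             (∀ j → count (λ u → f u ∧ G j u) ≤ 1) → count (λ u → f u ∧ ⋃ G u) ≤ t
count-∧-⋃≤ {zero}  f G _ = ℕₚ.≤-reflexive (count-none _ (λ u → Boolₚ.∧-zeroʳ (f u)))
count-∧-⋃≤ {suc t} f G ≤1 = begin
  count (λ u → f u ∧ (G zero u ∨ ⋃ (G ∘ suc) u))
    ≡⟨ count-cong (λ u → Boolₚ.∧-distribˡ-∨ (f u) (G zero u) (⋃ (G ∘ suc) u)) ⟩
  count (λ u → (f u ∧ G zero u) ∨ (f u ∧ ⋃ (G ∘ suc) u))
    ≤⟨ count-∨≤ (λ u → f u ∧ G zero u) (λ u → f u ∧ ⋃ (G ∘ suc) u) ⟩
  count (λ u → f u ∧ G zero u) + count (λ u → f u ∧ ⋃ (G ∘ suc) u)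
    ≤⟨ ℕₚ.+-mono-≤ (≤1 zero) (count-∧-⋃≤ f (G ∘ suc) (≤1 ∘ suc)) ⟩
  1 + t ∎
  where open ℕₚ.≤-Reasoning

suc-choose-2 : ∀ s → suc s choose 2 ≡ s + s choose 2
suc-choose-2 s = trans (sym (nCk+nC[k+1]≡[n+1]C[k+1] s 1)) (cong (_+ s choose 2) (nC1≡n s))

2*choose-2≤square : ∀ s → 2 * (s choose 2) ≤ s * s
2*choose-2≤square zero    = z≤n
2*choose-2≤square (suc s) = begin
  2 * (suc s choose 2)     ≡⟨ cong (2 *_) (suc-choose-2 s) ⟩
  2 * (s + s choose 2)     ≡⟨ ℕₚ.*-distribˡ-+ 2 s (s choose 2) ⟩
  2 * s + 2 * (s choose 2) ≤⟨ ℕₚ.+-monoʳ-≤ (2 * s) (2*choose-2≤square s) ⟩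
  2 * s + s * s            <⟨ ℕₚ.n<1+n _ ⟩
  suc (2 * s + s * s)      ≡⟨ e s ⟩
  suc s * suc s            ∎
  where
  open ℕₚ.≤-Reasoning
  e : ∀ s → suc (2 * s + s * s) ≡ suc s * suc s
  e = solve-∀

overlap-bound : ∀ {t n} (F : Fin t → Fin n → Bool) {a b : ℕ} →
                (∀ i j → i Fin.< j → count (λ u → F i u ∧ F j u) ≤ 1) →
                (∀ i → a ≤ b * count (F i)) →
                t * a ≤ b * (count (⋃ F) + t choose 2)
overlap-bound {zero}  F _ _ = z≤n
overlap-bound {suc t} F {a} {b} ≤1 large = begin
  a + t * a
    ≤⟨ ℕₚ.+-mono-≤ (large zero)
         (overlap-bound R {a} {b} (λ i j i<j → ≤1 (suc i) (suc j) (s≤s i<j)) (large ∘ suc)) ⟩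
  b * count F₀ + b * (count (⋃ R) + t choose 2)
    ≡⟨ sym (ℕₚ.*-distribˡ-+ b (count F₀) _) ⟩
  b * (count F₀ + (count (⋃ R) + t choose 2))
    ≡⟨ cong (b *_) (sym (ℕₚ.+-assoc (count F₀) _ _)) ⟩
  b * ((count F₀ + count (⋃ R)) + t choose 2)
    ≡⟨ cong (λ k → b * (k + t choose 2)) (count-∨-∧ F₀ (⋃ R)) ⟩
  b * ((count (⋃ F) + count (λ u → F₀ u ∧ ⋃ R u)) + t choose 2)
    ≤⟨ ℕₚ.*-monoʳ-≤ b (ℕₚ.+-monoˡ-≤ (t choose 2) (ℕₚ.+-monoʳ-≤ (count (⋃ F))
         (count-∧-⋃≤ F₀ R (λ j → ≤1 zero (suc j) (s≤s z≤n))))) ⟩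
  b * ((count (⋃ F) + t) + t choose 2)
    ≡⟨ cong (b *_) (trans (ℕₚ.+-assoc (count (⋃ F)) t _) (cong (count (⋃ F) +_) (sym (suc-choose-2 t)))) ⟩
  b * (count (⋃ F) + suc t choose 2) ∎
  where
  open ℕₚ.≤-Reasoning
  F₀ = F zero
  R  = F ∘ suc

-- Colourings

Proper : ∀ {n m} → Digraph n → (Fin n → Fin m) → Set
Proper D f = ∀ u v → Arc D u v → f u ≢ f v

proper? : ∀ {n m} (D : Digraph n) (f : Fin n → Fin m) → Dec (Proper D f)
proper? D f = Finₚ.all? λ u → Finₚ.all? λ v → (arc D u v Boolₚ.≟ true) →-dec ¬? (f u Finₚ.≟ f v)

colourable? : ∀ {n} (D : Digraph n) m → Dec (Colourable D m)
colourable? D m with Finₚ.any? (λ i → proper? D (Fin.finToFun i))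
... | yes (i , proper) = yes (Fin.finToFun i , proper)
... | no ¬proper       = no λ (f , proper) → ¬proper (Fin.funToFin f , λ u v uv eq →
  proper u v uv (trans (sym (Finₚ.finToFun-funToFin f u)) (trans eq (Finₚ.finToFun-funToFin f v))))

colourable-mono : ∀ {n m m′} (D : Digraph n) → m ≤ m′ → Colourable D m → Colourable D m′
colourable-mono D m≤m′ (f , proper) =
  (λ u → Fin.inject≤ (f u) m≤m′) ,
  λ u v uv eq → proper u v uv (Finₚ.inject≤-injective m≤m′ m≤m′ (f u) (f v) eq)

colourable⊎χ≥ : ∀ {n} (D : Digraph n) m → Colourable D m ⊎ ChiAtLeastℕ D (suc m)
colourable⊎χ≥ D m with colourable? D m
... | yes colourable = inj₁ colourable
... | no ¬colourable = inj₂ λ m′ colourable′ →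
  ℕₚ.≰⇒> λ m′≤m → ¬colourable (colourable-mono D m′≤m colourable′)

-- Colours are natural numbers, constrained only on S, so that colourings of different vertex sets
-- combine without choosing default colours.
record ColourableOn {n : ℕ} (D : Digraph n) (S : Fin n → Bool) (m : ℕ) : Set where
  constructor colouring
  field
    colour  : Fin n → ℕ
    bounded : ∀ u → S u ≡ true → colour u < m
    proper  : ∀ u v → S u ≡ true → S v ≡ true → Arc D u v → colour u ≢ colour v

⁅_⁆ : ∀ {n} → Fin n → Fin n → Bool
⁅ x ⁆ u = does (u Finₚ.≟ x)

_∪_ : ∀ {n} → (Fin n → Bool) → (Fin n → Bool) → Fin n → Bool
(S ∪ S′) u = S u ∨ S′ u

⁅⁆-sound : ∀ {n} {x u : Fin n} → ⁅ x ⁆ u ≡ true → u ≡ x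
⁅⁆-sound {x = x} {u} ux with u Finₚ.≟ x
... | yes u≡x = u≡x

module _ {n : ℕ} (D : Digraph n) where

  ColourableOn-⁅⁆ : ∀ x → ColourableOn D ⁅ x ⁆ 1
  ColourableOn-⁅⁆ x = colouring (const 0) (λ _ _ → s≤s z≤n) λ u v ux vx uv _ →
    Arc-irrefl D x (subst₂ (Arc D) (⁅⁆-sound ux) (⁅⁆-sound vx) uv)

  ColourableOn-∪ : ∀ {S S′ m m′} → ColourableOn D S m → ColourableOn D S′ m′ →
                   ColourableOn D (S ∪ S′) (m + m′)
  ColourableOn-∪ {S} {S′} {m} {m′} (colouring f f< f-proper) (colouring g g< g-proper) = colouring h h< h-proper
    where
    h : Fin n → ℕ
    h u = if S u then f u else m + g u
    h< : ∀ u → (S ∪ S′) u ≡ true → h u < m + m′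
    h< u su with S u in eu
    ... | true  = ℕₚ.<-≤-trans (f< u eu) (ℕₚ.m≤m+n m m′)
    ... | false = ℕₚ.+-monoʳ-< m (g< u su)
    h-proper : ∀ u v → (S ∪ S′) u ≡ true → (S ∪ S′) v ≡ true → Arc D u v → h u ≢ h v
    h-proper u v su sv uv with S u in eu | S v in ev
    ... | true  | true  = f-proper u v eu ev uv
    ... | false | false = g-proper u v su sv uv ∘ ℕₚ.+-cancelˡ-≡ m (g u) (g v)
    ... | true  | false = ℕₚ.<⇒≢ (ℕₚ.<-≤-trans (f< u eu) (ℕₚ.m≤m+n m (g v)))
    ... | false | true  = ℕₚ.<⇒≢ (ℕₚ.<-≤-trans (f< v ev) (ℕₚ.m≤m+n m (g u))) ∘ sym

  cover⇒colourable : ∀ {t m} (S : Fin t → Fin n → Bool) → (∀ i → ColourableOn D (S i) m) →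
                     (∀ u → ∃ λ i → S i u ≡ true) → Colourable D (t * m)
  cover⇒colourable {t} {m} S colourOn cover =
    (λ u → colourVia u (cover u)) , λ u v uv → proper u v (cover u) (cover v) uv
    where
    colourVia : ∀ u → (∃ λ i → S i u ≡ true) → Fin (t * m)
    colourVia u (i , su) = Fin.combine i (Fin.fromℕ< (ColourableOn.bounded (colourOn i) u su))
    proper : ∀ u v cu cv → Arc D u v → colourVia u cu ≢ colourVia v cv
    proper u v (i , su) (j , sv) uv eq with Finₚ.combine-injective i _ j _ eq
    ... | refl , same = ColourableOn.proper (colourOn i) u v su sv uv (Finₚ.fromℕ<-injective _ _ _ _ same)

-- Induced subdigraphs and embeddings

lookup-injective : ∀ {A : Set} {xs : List A} → Unique xs → ∀ i j → lookup xs i ≡ lookup xs j → i ≡ j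
lookup-injective (_ ∷ _)      zero    zero    _  = refl
lookup-injective (x∉xs ∷ _)   zero    (suc j) eq = contradiction eq (All.lookup x∉xs (∈-lookup j))
lookup-injective (x∉xs ∷ _)   (suc i) zero    eq = contradiction (sym eq) (All.lookup x∉xs (∈-lookup i))
lookup-injective (_ ∷ unique) (suc i) (suc j) eq = cong suc (lookup-injective unique i j eq)

module _ {n : ℕ} (S : Fin n → Bool) where

  private
    S? : (u : Fin n) → Dec (S u ≡ true)
    S? u = S u Boolₚ.≟ true

  members : List (Fin n)
  members = filter S? (allFin n)

  member : Fin (length members) → Fin n
  member = lookup members

  member∈ : ∀ i → S (member i) ≡ true
  member∈ i = proj₂ (∈-filter⁻ S? {xs = allFin n} (∈-lookup i))

  member-injective : ∀ i j → member i ≡ member j → i ≡ j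
  member-injective = lookup-injective (AllPairs.filter⁺ S? (allFin⁺ n))

  member-surjective : ∀ u → S u ≡ true → ∃ λ i → member i ≡ u
  member-surjective u su = Any.index u∈ , sym (lookup-index u∈)
    where
    u∈ = ∈-filter⁺ S? (∈-allFin u) su

induced : ∀ {n} (D : Digraph n) (S : Fin n → Bool) → Digraph (length (members S))
induced D S = record { arc = λ i j → arc D (member S i) (member S j) ; loopless = loopless D ∘ member S }

record IsEmbedding {h n : ℕ} (H : Digraph h) (D : Digraph n) (φ : Fin h → Fin n) : Set where
  constructor embedding
  field
    injective      : ∀ a b → φ a ≡ φ b → a ≡ b
    arc-preserving : ∀ a b → Arc H a b → Arc D (φ a) (φ b)

module _ {n : ℕ} (D : Digraph n) (S : Fin n → Bool) where

  induced-embedding : ∀ {h} {H : Digraph h} → Contains (induced D S) H →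
                      ∃ λ φ → IsEmbedding H D φ × (∀ a → S (φ a) ≡ true)
  induced-embedding (ψ , ψ-injective , ψ-arc) =
    member S ∘ ψ , embedding (λ a b eq → ψ-injective a b (member-injective S _ _ eq)) ψ-arc , member∈ S ∘ ψ

  induced-colourable : ∀ {m} → Colourable (induced D S) m → ColourableOn D S m
  induced-colourable {m} (g , g-proper) = colouring colour colour< colour-proper
    where
    colour : Fin n → ℕ
    colour u with Finₚ.any? (λ i → member S i Finₚ.≟ u)
    ... | yes (i , _) = toℕ (g i)
    ... | no _        = 0
    colour-spec : ∀ u → S u ≡ true → ∃ λ i → member S i ≡ u × colour u ≡ toℕ (g i)
    colour-spec u su with Finₚ.any? (λ i → member S i Finₚ.≟ u)
    ... | yes (i , eq) = i , eq , refl
    ... | no ∄i        = contradiction (member-surjective S u su) ∄i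
    colour< : ∀ u → S u ≡ true → colour u < m
    colour< u su = let (i , _ , eq) = colour-spec u su in subst (_< m) (sym eq) (Finₚ.toℕ<n (g i))
    colour-proper : ∀ u v → S u ≡ true → S v ≡ true → Arc D u v → colour u ≢ colour v
    colour-proper u v su sv uv eq with colour-spec u su | colour-spec v sv
    ... | i , refl , eu | j , refl , ev = g-proper i j uv (Finₚ.toℕ-injective (trans (sym eu) (trans eq ev)))

orient : ∀ {n} → Digraph n → Digraph n
orient D = record
  { arc      = λ u v → arc D u v ∧ (not (arc D v u) ∨ (toℕ u ℕ.<ᵇ toℕ v))
  ; loopless = λ v → cong (λ b → b ∧ (not (arc D v v) ∨ (toℕ v ℕ.<ᵇ toℕ v))) (loopless D v)
  }

module _ {n : ℕ} (D : Digraph n) where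

  orient⊆ : ∀ u v → Arc (orient D) u v → Arc D u v
  orient⊆ u v = proj₁ ∘ ∧-true

  orient-oriented : Oriented (orient D)
  orient-oriented u v uv vu = ℕₚ.<-asym (forward u v uv (orient⊆ v u vu)) (forward v u vu (orient⊆ u v uv))
    where
    forward : ∀ a b → Arc (orient D) a b → Arc D b a → toℕ a < toℕ b
    forward a b ab ba = ℕₚ.<ᵇ⇒< (toℕ a) (toℕ b)
      (Equivalence.from Boolₚ.T-≡ (subst (λ x → not x ∨ (toℕ a ℕ.<ᵇ toℕ b) ≡ true) ba (proj₂ (∧-true ab))))

  orient-adj : ∀ u v → Arc D u v → Adj (orient D) u v
  orient-adj u v uv with arc D v u in vu
  ... | false = inj₁ (cong (_∧ true) uv)
  ... | true with ℕₚ.<-cmp (toℕ u) (toℕ v)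
  ... | tri< u<v _ _ = inj₁ (cong₂ _∧_ uv (Equivalence.to Boolₚ.T-≡ (ℕₚ.<⇒<ᵇ u<v)))
  ... | tri≈ _ u≡v _ = contradiction (subst (Arc D u) (sym (Finₚ.toℕ-injective u≡v)) uv) (Arc-irrefl D u)
  ... | tri> _ _ v<u = inj₂ (cong₂ _∨_ (cong not uv) (Equivalence.to Boolₚ.T-≡ (ℕₚ.<⇒<ᵇ v<u)))

  χ≥-orient : ∀ {c} → ChiAtLeastℕ D c → ChiAtLeastℕ (orient D) c
  χ≥-orient χ≥c m (f , proper) =
    χ≥c m (f , λ u v uv → [ proper u v , (λ vu → proper v u vu ∘ sym) ] (orient-adj u v uv))

  contains-orient : ∀ {h} {H : Digraph h} → Contains (orient D) H → Contains D H
  contains-orient (φ , φ-injective , φ-arc) = φ , φ-injective , λ a b ab → orient⊆ (φ a) (φ b) (φ-arc a b ab)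

-- Trees from cycles

_++ʷ_ : ∀ {n} {D : Digraph n} {u v x} → Walk D u v → Walk D v x → Walk D u x
here       ++ʷ q = q
step uw p ++ʷ q = step uw (p ++ʷ q)

reverseʷ : ∀ {n} {D : Digraph n} {u v} → Walk D u v → Walk D v u
reverseʷ here        = here
reverseʷ (step uw p) = reverseʷ p ++ʷ step (Sum.swap uw) here

argmax : ∀ {n} (H : Fin (suc n) → ℕ) → ∃ λ m → ∀ i → H i ≤ H m
argmax {zero}  H = zero , λ { zero → ℕₚ.≤-refl }
argmax {suc n} H with argmax (H ∘ suc)
... | m , max with H zero ℕₚ.≤? H (suc m)
... | yes H₀≤ = suc m , λ { zero → H₀≤ ; (suc i) → max i }
... | no  H₀≰ = zero , λ { zero → ℕₚ.≤-refl
                         ; (suc i) → ℕₚ.≤-trans (max i) (ℕₚ.<⇒≤ (ℕₚ.≰⇒> H₀≰)) }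

module _ {n r : ℕ} {D : Digraph n} (g : Fin (3 + r) → Fin n)
         (g-step : ∀ (i : Fin (2 + r)) → Adj D (g (Fin.inject₁ i)) (g (suc i)))
         (g-close : Adj D (g (Fin.fromℕ (2 + r))) (g zero)) where

  cyclic-neighbours : ∀ m → ∃₂ λ x y → x ≢ y × Adj D (g m) (g x) × Adj D (g m) (g y)
  cyclic-neighbours zero = suc zero , Fin.fromℕ (2 + r) , (λ ()) , g-step zero , Sum.swap g-close
  cyclic-neighbours (suc m) with Top.view m
  ... | Top.‵fromℕ     = Fin.inject₁ m , zero , (λ ()) , Sum.swap (g-step m) , g-close
  ... | Top.‵inject₁ i = Fin.inject₁ m , suc (suc i) , inject₁≢suc , Sum.swap (g-step m) , g-step (suc i)
    where
    inject₁≢suc : Fin.inject₁ (Fin.inject₁ i) ≢ suc (suc i)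
    inject₁≢suc eq = ℕₚ.<⇒≢ (ℕₚ.m<n+m (toℕ i) {2} (s≤s z≤n))
      (trans (sym (trans (Finₚ.toℕ-inject₁ (Fin.inject₁ i)) (Finₚ.toℕ-inject₁ i))) (cong toℕ eq))

module _ {j : ℕ} (T : Digraph j) (h : Fin j → ℕ) (h-injective : ∀ a b → h a ≡ h b → a ≡ b) where

  -- At a highest vertex of a cycle both cyclic neighbours are one level lower, hence equal.
  graded⇒acyclic : (∀ a b → Adj T a b → h b ≡ suc (h a) ⊎ h a ≡ suc (h b)) → ¬ HasCycle T
  graded⇒acyclic h-step (r , g , g-injective , g-step , g-close) with argmax (h ∘ g)
  ... | m , max with cyclic-neighbours {D = T} g g-step g-close m
  ... | x , y , x≢y , m~x , m~y =
    x≢y (g-injective x y (h-injective (g x) (g y) (ℕₚ.suc-injective (trans (sym (below x m~x)) (below y m~y)))))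
    where
    below : ∀ z → Adj T (g m) (g z) → h (g m) ≡ suc (h (g z))
    below z m~z with h-step (g m) (g z) m~z
    ... | inj₁ up   = contradiction (max z) (ℕₚ.<⇒≱ (ℕₚ.≤-reflexive (sym up)))
    ... | inj₂ down = down

  graded⇒connected : (∀ a → 1 ≤ h a) → (∀ a → 2 ≤ h a → ∃ λ b → Adj T a b × h a ≡ suc (h b)) →
                     Connected T
  graded⇒connected h-pos h-descend a b = meet (descend a) (descend b)
    where
    descend-from : ∀ k a → h a ≡ suc k → ∃ λ b → h b ≡ 1 × Walk T a b
    descend-from zero    a ha = a , ha , here
    descend-from (suc k) a ha with h-descend a (subst (2 ≤_) (sym ha) (s≤s (s≤s z≤n)))
    ... | b , a~b , ha≡ with descend-from k b (ℕₚ.suc-injective (trans (sym ha≡) ha))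
    ... | c , hc , b⇝c = c , hc , step a~b b⇝c
    descend : ∀ a → ∃ λ b → h b ≡ 1 × Walk T a b
    descend a = descend-from (ℕ.pred (h a)) a (sym (ℕₚ.suc-pred (h a) {{ℕ.>-nonZero (h-pos a)}}))
    meet : ∀ {a b} → (∃ λ c → h c ≡ 1 × Walk T a c) → (∃ λ d → h d ≡ 1 × Walk T b d) → Walk T a b
    meet (c , hc , a⇝c) (d , hd , b⇝d) with h-injective c d (trans hc (sym hd))
    ... | refl = a⇝c ++ʷ reverseʷ b⇝d

_─_ : ∀ {j} → Digraph (suc j) → Fin (suc j) → Digraph j
C ─ w = record { arc = λ a b → arc C (Fin.punchIn w a) (Fin.punchIn w b) ; loopless = loopless C ∘ Fin.punchIn w }

module _ {k : ℕ} (w : Fin k) where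

  -- the number of steps from w to v along 0 → 1 → ⋯ → k - 1 → 0 (a full turn, k, when v = w)
  steps : Fin k → ℕ
  steps v with toℕ w ℕₚ.<? toℕ v
  ... | yes _ = toℕ v ∸ toℕ w
  ... | no  _ = (toℕ v + k) ∸ toℕ w

  steps-spec : ∀ v → v ≢ w → (toℕ w < toℕ v × steps v + toℕ w ≡ toℕ v)
                            ⊎ (toℕ v < toℕ w × steps v + toℕ w ≡ toℕ v + k)
  steps-spec v v≢w with toℕ w ℕₚ.<? toℕ v
  ... | yes w<v = inj₁ (w<v , ℕₚ.m∸n+n≡m (ℕₚ.<⇒≤ w<v))
  ... | no  w≮v = inj₂ (v<w , ℕₚ.m∸n+n≡m (ℕₚ.≤-trans (ℕₚ.<⇒≤ (Finₚ.toℕ<n w)) (ℕₚ.m≤n+m k (toℕ v))))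
    where
    v<w : toℕ v < toℕ w
    v<w = ℕₚ.≤∧≢⇒< (ℕₚ.≮⇒≥ w≮v) (v≢w ∘ Finₚ.toℕ-injective)

  private
    b = toℕ w
    w<k : b < k
    w<k = Finₚ.toℕ<n w

  steps-injective : ∀ u v → u ≢ w → v ≢ w → steps u ≡ steps v → u ≡ v
  steps-injective u v u≢w v≢w eq with steps-spec u u≢w | steps-spec v v≢w
  ... | inj₁ (_ , eu) | inj₁ (_ , ev) = Finₚ.toℕ-injective (trans (sym eu) (trans (cong (_+ b) eq) ev))
  ... | inj₂ (_ , eu) | inj₂ (_ , ev) =
    Finₚ.toℕ-injective (ℕₚ.+-cancelʳ-≡ k _ _ (trans (sym eu) (trans (cong (_+ b) eq) ev)))
  ... | inj₁ (_ , eu) | inj₂ (_ , ev) = contradiction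
    (subst (k ≤_) (trans (sym ev) (trans (cong (_+ b) (sym eq)) eu)) (ℕₚ.m≤n+m k (toℕ v)))
    (ℕₚ.<⇒≱ (Finₚ.toℕ<n u))
  ... | inj₂ (_ , eu) | inj₁ (_ , ev) = contradiction
    (subst (k ≤_) (trans (sym eu) (trans (cong (_+ b) eq) ev)) (ℕₚ.m≤n+m k (toℕ u)))
    (ℕₚ.<⇒≱ (Finₚ.toℕ<n v))

  steps-pos : ∀ v → v ≢ w → 1 ≤ steps v
  steps-pos v v≢w with steps v | steps-spec v v≢w
  ... | suc _ | _               = s≤s z≤n
  ... | zero  | inj₁ (w<v , ev) = contradiction ev (ℕₚ.<⇒≢ w<v)
  ... | zero  | inj₂ (_ , ev)   = contradiction (subst (k ≤_) (sym ev) (ℕₚ.m≤n+m k (toℕ v))) (ℕₚ.<⇒≱ w<k)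

  steps-suc : ∀ u v → u ≢ w → v ≢ w → CycSucc k u v → steps v ≡ suc (steps u)
  steps-suc u v u≢w v≢w (inj₁ u+1≡v) with steps-spec u u≢w | steps-spec v v≢w
  ... | inj₁ (_ , eu) | inj₁ (_ , ev) = ℕₚ.+-cancelʳ-≡ b _ _ (trans ev (trans (sym u+1≡v) (cong suc (sym eu))))
  ... | inj₂ (_ , eu) | inj₂ (_ , ev) =
    ℕₚ.+-cancelʳ-≡ b _ _ (trans ev (trans (cong (_+ k) (sym u+1≡v)) (cong suc (sym eu))))
  ... | inj₁ (w<u , _) | inj₂ (v<w , _) =
    contradiction (ℕₚ.<-trans w<u (ℕₚ.<-trans (ℕₚ.n<1+n (toℕ u)) (subst (_< b) (sym u+1≡v) v<w)))
                  (ℕₚ.<-irrefl refl)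
  ... | inj₂ (u<w , _) | inj₁ (w<v , _) =
    contradiction (ℕₚ.<-≤-trans u<w (ℕₚ.≤-pred (subst (b <_) (sym u+1≡v) w<v))) (ℕₚ.<-irrefl refl)
  steps-suc u v u≢w v≢w (inj₂ (u+1≡k , v≡0)) with steps-spec u u≢w | steps-spec v v≢w
  ... | _ | inj₁ (w<v , _) = contradiction (subst (b <_) v≡0 w<v) (λ ())
  ... | inj₂ (u<w , _) | _ = contradiction (subst (b <_) (sym u+1≡k) w<k) (ℕₚ.<⇒≱ u<w ∘ ℕₚ.≤-pred)
  ... | inj₁ (_ , eu) | inj₂ (_ , ev) =
    ℕₚ.+-cancelʳ-≡ b _ _ (trans ev (trans (cong (_+ k) v≡0) (trans (sym u+1≡k) (cong suc (sym eu)))))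

  steps-first : ∀ v → v ≢ w → CycSucc k w v → steps v ≡ 1
  steps-first v v≢w (inj₁ w+1≡v) with steps-spec v v≢w
  ... | inj₁ (_ , ev)   = ℕₚ.+-cancelʳ-≡ b _ 1 (trans ev (sym w+1≡v))
  ... | inj₂ (v<w , _) = contradiction (subst (b <_) w+1≡v (ℕₚ.n<1+n b)) (ℕₚ.<-asym v<w)
  steps-first v v≢w (inj₂ (w+1≡k , v≡0)) with steps-spec v v≢w
  ... | inj₁ (w<v , _) = contradiction (subst (b <_) v≡0 w<v) (λ ())
  ... | inj₂ (_ , ev)   = ℕₚ.+-cancelʳ-≡ b _ 1 (trans ev (trans (cong (_+ k) v≡0) (sym w+1≡k)))

cycle-pred : ∀ {j} → Fin (suc j) → Fin (suc j)
cycle-pred {j} zero = Fin.fromℕ j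
cycle-pred (suc u)  = Fin.inject₁ u

cycle-pred-succ : ∀ {j} (v : Fin (suc j)) → CycSucc (suc j) (cycle-pred v) v
cycle-pred-succ {j} zero = inj₂ (cong suc (Finₚ.toℕ-fromℕ j) , refl)
cycle-pred-succ (suc u)  = inj₁ (cong suc (Finₚ.toℕ-inject₁ u))

module _ {j : ℕ} (C : Digraph (suc j)) (oc : OrientedCycle (suc j) C) (w : Fin (suc j)) where

  private
    ι : Fin j → Fin (suc j)
    ι = Fin.punchIn w

    ι≢w : ∀ a → ι a ≢ w
    ι≢w = Finₚ.punchInᵢ≢i w

    h : Fin j → ℕ
    h = steps w ∘ ι

    h-injective : ∀ a b → h a ≡ h b → a ≡ b
    h-injective a b eq = Finₚ.punchIn-injective w a b (steps-injective w (ι a) (ι b) (ι≢w a) (ι≢w b) eq)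

    h-step : ∀ a b → Adj (C ─ w) a b → h b ≡ suc (h a) ⊎ h a ≡ suc (h b)
    h-step a b a~b with proj₁ (proj₂ oc) (ι a) (ι b) a~b
    ... | inj₁ a→b = inj₁ (steps-suc w (ι a) (ι b) (ι≢w a) (ι≢w b) a→b)
    ... | inj₂ b→a = inj₂ (steps-suc w (ι b) (ι a) (ι≢w b) (ι≢w a) b→a)

    h-descend : ∀ a → 2 ≤ h a → ∃ λ b → Adj (C ─ w) a b × h a ≡ suc (h b)
    h-descend a 2≤ha = b , Sum.swap (subst (λ x → Adj C x (ι a)) (sym ιb≡p) p~a) , ha≡
      where
      p = cycle-pred (ι a)
      w≢p : w ≢ p
      w≢p w≡p = ℕₚ.<⇒≢ 2≤ha (sym (steps-first w (ι a) (ι≢w a)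
        (subst (λ x → CycSucc (suc j) x (ι a)) (sym w≡p) (cycle-pred-succ (ι a)))))
      b = Fin.punchOut w≢p
      ιb≡p : ι b ≡ p
      ιb≡p = Finₚ.punchIn-punchOut w≢p
      p~a : Adj C p (ι a)
      p~a = proj₂ (proj₂ oc) p (ι a) (inj₁ (cycle-pred-succ (ι a)))
      ha≡ : h a ≡ suc (h b)
      ha≡ = trans (steps-suc w p (ι a) (w≢p ∘ sym) (ι≢w a) (cycle-pred-succ (ι a))) (cong (suc ∘ steps w) (sym ιb≡p))

  cycle─vertex-tree : OrientedTree (C ─ w)
  cycle─vertex-tree =
      (λ a b → proj₁ oc (ι a) (ι b))
    , graded⇒connected (C ─ w) h h-injective (λ a → steps-pos w (ι a) (ι≢w a)) h-descend
    , graded⇒acyclic (C ─ w) h h-injective h-step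

-- Modifying embeddings

module _ {k : ℕ} where

  CycSucc-functional : ∀ {a b b′ : Fin k} → CycSucc k a b → CycSucc k a b′ → b ≡ b′
  CycSucc-functional (inj₁ ab) (inj₁ ab′) = Finₚ.toℕ-injective (trans (sym ab) ab′)
  CycSucc-functional {b = b} (inj₁ ab) (inj₂ (ak , _)) =
    contradiction (trans (sym ab) ak) (ℕₚ.<⇒≢ (Finₚ.toℕ<n b))
  CycSucc-functional {b′ = b′} (inj₂ (ak , _)) (inj₁ ab′) =
    contradiction (trans (sym ab′) ak) (ℕₚ.<⇒≢ (Finₚ.toℕ<n b′))
  CycSucc-functional (inj₂ (_ , b≡0)) (inj₂ (_ , b′≡0)) = Finₚ.toℕ-injective (trans b≡0 (sym b′≡0))

  CycSucc-injective : ∀ {a a′ b : Fin k} → CycSucc k a b → CycSucc k a′ b → a ≡ a′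
  CycSucc-injective (inj₁ ab) (inj₁ a′b)             = Finₚ.toℕ-injective (ℕₚ.suc-injective (trans ab (sym a′b)))
  CycSucc-injective (inj₁ ab) (inj₂ (_ , b≡0))       = contradiction (trans ab b≡0) (λ ())
  CycSucc-injective (inj₂ (_ , b≡0)) (inj₁ a′b)      = contradiction (trans a′b b≡0) (λ ())
  CycSucc-injective (inj₂ (ak , _)) (inj₂ (a′k , _)) = Finₚ.toℕ-injective (ℕₚ.suc-injective (trans ak (sym a′k)))

  CycAdj-two : ∀ {w u u₁ u₂ : Fin k} → CycAdj k w u₁ → CycAdj k w u₂ → u₁ ≢ u₂ →
               CycAdj k w u → u ≡ u₁ ⊎ u ≡ u₂
  CycAdj-two (inj₁ s₁) (inj₁ s₂) u₁≢u₂ _    = contradiction (CycSucc-functional s₁ s₂) u₁≢u₂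
  CycAdj-two (inj₂ s₁) (inj₂ s₂) u₁≢u₂ _    = contradiction (CycSucc-injective s₁ s₂) u₁≢u₂
  CycAdj-two (inj₁ s₁) (inj₂ s₂) _ (inj₁ s) = inj₁ (CycSucc-functional s s₁)
  CycAdj-two (inj₁ s₁) (inj₂ s₂) _ (inj₂ s) = inj₂ (CycSucc-injective s s₂)
  CycAdj-two (inj₂ s₁) (inj₁ s₂) _ (inj₁ s) = inj₂ (CycSucc-functional s s₂)
  CycAdj-two (inj₂ s₁) (inj₁ s₂) _ (inj₂ s) = inj₁ (CycSucc-injective s s₁)

module OrientedCycleNeighbours {k : ℕ} {C : Digraph k} (oc : OrientedCycle k C)
                               {w u₁ u₂ : Fin k} (u₁≢u₂ : u₁ ≢ u₂) where

  private
    Adj-two : Adj C w u₁ → Adj C w u₂ → ∀ {u} → Adj C w u → u ≡ u₁ ⊎ u ≡ u₂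
    Adj-two w~u₁ w~u₂ w~u = CycAdj-two (cyc w~u₁) (cyc w~u₂) u₁≢u₂ (cyc w~u)
      where
      cyc : ∀ {v} → Adj C w v → CycAdj k w v
      cyc = proj₁ (proj₂ oc) w _

  source-out : Arc C w u₁ → Arc C w u₂ → ∀ {u} → Arc C w u → u ≡ u₁ ⊎ u ≡ u₂
  source-out w→u₁ w→u₂ w→u = Adj-two (inj₁ w→u₁) (inj₁ w→u₂) (inj₁ w→u)

  source-in : Arc C w u₁ → Arc C w u₂ → ∀ {u} → ¬ Arc C u w
  source-in w→u₁ w→u₂ u→w with Adj-two (inj₁ w→u₁) (inj₁ w→u₂) (inj₂ u→w)
  ... | inj₁ refl = proj₁ oc w _ w→u₁ u→w
  ... | inj₂ refl = proj₁ oc w _ w→u₂ u→w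

  sink-in : Arc C u₁ w → Arc C u₂ w → ∀ {u} → Arc C u w → u ≡ u₁ ⊎ u ≡ u₂
  sink-in u₁→w u₂→w u→w = Adj-two (inj₂ u₁→w) (inj₂ u₂→w) (inj₂ u→w)

  sink-out : Arc C u₁ w → Arc C u₂ w → ∀ {u} → ¬ Arc C w u
  sink-out u₁→w u₂→w w→u with Adj-two (inj₂ u₁→w) (inj₂ u₂→w) (inj₁ w→u)
  ... | inj₁ refl = proj₁ oc _ w u₁→w w→u
  ... | inj₂ refl = proj₁ oc _ w u₂→w w→u

data Punctured {j : ℕ} (w : Fin (suc j)) : Fin (suc j) → Set where
  centre  : Punctured w w
  punched : (a : Fin j) → Punctured w (Fin.punchIn w a)

punctured : ∀ {j} (w v : Fin (suc j)) → Punctured w v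
punctured w v with w Finₚ.≟ v
... | yes refl = centre
... | no  w≢v  = subst (Punctured w) (Finₚ.punchIn-punchOut w≢v) (punched (Fin.punchOut w≢v))

module _ {j n : ℕ} (C : Digraph (suc j)) {D : Digraph n} (w : Fin (suc j)) {φ : Fin j → Fin n}
         (φ-embedding : IsEmbedding (C ─ w) D φ) (x : Fin n) (x-new : ∀ a → φ a ≢ x)
         (x-out : ∀ a → Arc C w (Fin.punchIn w a) → Arc D x (φ a))
         (x-in : ∀ a → Arc C (Fin.punchIn w a) w → Arc D (φ a) x) where

  open IsEmbedding φ-embedding

  private
    Φ : ∀ {v} → Punctured w v → Fin n
    Φ centre      = x
    Φ (punched a) = φ a

    Φ-injective : ∀ {u v} (pu : Punctured w u) (pv : Punctured w v) → Φ pu ≡ Φ pv → u ≡ v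
    Φ-injective centre      centre      _  = refl
    Φ-injective centre      (punched b) eq = contradiction (sym eq) (x-new b)
    Φ-injective (punched a) centre      eq = contradiction eq (x-new a)
    Φ-injective (punched a) (punched b) eq = cong (Fin.punchIn w) (injective a b eq)

    Φ-arc : ∀ {u v} (pu : Punctured w u) (pv : Punctured w v) → Arc C u v → Arc D (Φ pu) (Φ pv)
    Φ-arc centre      centre      w→w = contradiction w→w (Arc-irrefl C w)
    Φ-arc centre      (punched b) w→b = x-out b w→b
    Φ-arc (punched a) centre      a→w = x-in a a→w
    Φ-arc (punched a) (punched b) a→b = arc-preserving a b a→b

  extend : Contains D C
  extend = (λ v → Φ (punctured w v))
         , (λ u v → Φ-injective (punctured w u) (punctured w v))
         , (λ u v → Φ-arc (punctured w u) (punctured w v))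

module _ {h n : ℕ} {H : Digraph h} {D : Digraph n} {φ : Fin h → Fin n} (φ-embedding : IsEmbedding H D φ)
         (a : Fin h) (y : Fin n) (y-new : ∀ b → b ≢ a → φ b ≢ y)
         (y-out : ∀ b → Arc H a b → Arc D y (φ b)) (y-in : ∀ b → Arc H b a → Arc D (φ b) y) where

  open IsEmbedding φ-embedding

  private
    ψ : Fin h → Fin n
    ψ = updateAt φ a (const y)

    ψ-at : ψ a ≡ y
    ψ-at = updateAt-updates a φ

    ψ-away : ∀ {b} → b ≢ a → ψ b ≡ φ b
    ψ-away {b} b≢a = updateAt-minimal b a φ b≢a

    ψ-injective : ∀ b c → ψ b ≡ ψ c → b ≡ c
    ψ-injective b c eq with b Finₚ.≟ a | c Finₚ.≟ a
    ... | yes refl | yes refl = refl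
    ... | yes refl | no c≢a   = contradiction (trans (sym (ψ-away c≢a)) (trans (sym eq) ψ-at)) (y-new c c≢a)
    ... | no b≢a   | yes refl = contradiction (trans (sym (ψ-away b≢a)) (trans eq ψ-at)) (y-new b b≢a)
    ... | no b≢a   | no c≢a   = injective b c (trans (sym (ψ-away b≢a)) (trans eq (ψ-away c≢a)))

    ψ-arc : ∀ b c → Arc H b c → Arc D (ψ b) (ψ c)
    ψ-arc b c b→c with b Finₚ.≟ a | c Finₚ.≟ a
    ... | yes refl | yes refl = contradiction b→c (Arc-irrefl H a)
    ... | yes refl | no c≢a   = subst₂ (Arc D) (sym ψ-at) (sym (ψ-away c≢a)) (y-out c b→c)
    ... | no b≢a   | yes refl = subst₂ (Arc D) (sym (ψ-away b≢a)) (sym ψ-at) (y-in b b→c)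
    ... | no b≢a   | no c≢a   = subst₂ (Arc D) (sym (ψ-away b≢a)) (sym (ψ-away c≢a)) (arc-preserving b c b→c)

  updateAt-embedding : IsEmbedding H D (updateAt φ a (const y))
  updateAt-embedding = embedding ψ-injective ψ-arc

updateAt-preserves : ∀ {h n} (P : Fin n → Set) {φ : Fin h → Fin n} (a : Fin h) {y : Fin n} →
                     (∀ b → P (φ b)) → P y → ∀ b → P (updateAt φ a (const y) b)
updateAt-preserves P {φ} a Pφ Py b with b Finₚ.≟ a
... | yes refl = subst P (sym (updateAt-updates a φ)) Py
... | no b≢a   = subst P (sym (updateAt-minimal b a φ b≢a)) (Pφ b)

-- Near sets

module _ {n : ℕ} (D : Digraph n) where

  commonOut : Fin n → Fin n → ℕ
  commonOut u x = count (λ y → arc D u y ∧ arc D x y)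

  wedge : Fin n → Fin n → Bool
  wedge x u = not (⁅ x ⁆ u ∨ arc D x u) ∧ (2 ℕ.≤ᵇ commonOut u x)

  near : Fin n → Fin n → Bool
  near x = ⁅ x ⁆ ∪ (arc D x ∪ wedge x)

  wedge-spec : ∀ x u → wedge x u ≡ true → u ≢ x × ¬ Arc D x u × 1 < commonOut u x
  wedge-spec x u u∈ with u Finₚ.≟ x | arc D x u
  wedge-spec x u () | yes _  | _
  wedge-spec x u () | no _   | true
  wedge-spec x u u∈ | no u≢x | false = u≢x , (λ ()) , ℕₚ.≤ᵇ⇒≤ 2 _ (Equivalence.from Boolₚ.T-≡ u∈)

  far⇒commonOut≤1 : ∀ x u → near x u ≡ false → commonOut u x ≤ 1
  far⇒commonOut≤1 x u far with u Finₚ.≟ x | arc D x u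
  far⇒commonOut≤1 x u ()  | yes _ | _
  far⇒commonOut≤1 x u ()  | no _  | true
  far⇒commonOut≤1 x u far | no _  | false = ℕₚ.≤-pred (ℕₚ.≰⇒> λ 2≤ → subst T far (ℕₚ.≤⇒≤ᵇ 2≤))

  near-colourable : ∀ {c} x → Colourable (induced D (arc D x)) c → Colourable (induced D (wedge x)) c →
                    ColourableOn D (near x) (1 + (c + c))
  near-colourable x out-colourable wedge-colourable =
    ColourableOn-∪ D (ColourableOn-⁅⁆ D x)
      (ColourableOn-∪ D (induced-colourable D (arc D x) out-colourable)
                        (induced-colourable D (wedge x) wedge-colourable))

far-family-or-cover : ∀ {n} (R : Fin n → Fin n → Bool) t →
    (∃ λ (L : Fin t → Fin n) → ∀ i j → i Fin.< j → R (L j) (L i) ≡ false)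
  ⊎ (∃₂ λ t′ (L : Fin t′ → Fin n) → t′ < t × ∀ u → ∃ λ i → R (L i) u ≡ true)
far-family-or-cover R zero = inj₁ ((λ ()) , λ ())
far-family-or-cover R (suc t) with far-family-or-cover R t
... | inj₂ (t′ , L , t′<t , covers) = inj₂ (t′ , L , ℕₚ.m<n⇒m<1+n t′<t , covers)
... | inj₁ (L , far) with Finₚ.any? (λ u → Finₚ.all? (λ i → R (L i) u Boolₚ.≟ false))
...   | yes (u , u-far) = inj₁ (u Vector.∷ L , far′)
  where
  far′ : ∀ i j → i Fin.< j → R ((u Vector.∷ L) j) ((u Vector.∷ L) i) ≡ false
  far′ zero    (suc j) _         = u-far j
  far′ (suc i) (suc j) (s≤s i<j) = far i j i<j
...   | no ∄u = inj₂ (t , L , ℕₚ.n<1+n t , covers)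
  where
  covers : ∀ u → ∃ λ i → R (L i) u ≡ true
  covers u with Finₚ.any? (λ i → R (L i) u Boolₚ.≟ true)
  ... | yes covered = covered
  ... | no ¬covered = contradiction (u , λ i → Boolₚ.¬-not (λ Rtrue → ¬covered (i , Rtrue))) ∄u

far-family-arithmetic : ∀ {n p q s} .{{_ : NonZero q}} → 12 * (q * q) ≤ n * (p * p) →
                        2 * q ≤ s * p → s * p ≤ 3 * q → s * (p * n) ≤ q * (n + s choose 2) → ⊥
far-family-arithmetic {n} {p} {q} {s} dense 2q≤sp sp≤3q bound = ℕₚ.<⇒≱ 9q²<24q² 24q²≤9q²
  where
  open ℕₚ.≤-Reasoning
  n≤choose : n ≤ s choose 2
  n≤choose = ℕₚ.*-cancelˡ-≤ q (ℕₚ.+-cancelˡ-≤ (q * n) _ _ (begin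
    q * n + q * n            ≡⟨ e q n ⟩
    2 * q * n                ≤⟨ ℕₚ.*-monoˡ-≤ n 2q≤sp ⟩
    s * p * n                ≡⟨ ℕₚ.*-assoc s p n ⟩
    s * (p * n)              ≤⟨ bound ⟩
    q * (n + s choose 2)     ≡⟨ ℕₚ.*-distribˡ-+ q n _ ⟩
    q * n + q * (s choose 2) ∎))
    where
    e : ∀ q n → q * n + q * n ≡ 2 * q * n
    e = solve-∀
  24q²≤9q² : 24 * (q * q) ≤ 9 * (q * q)
  24q²≤9q² = begin
    24 * (q * q)       ≡⟨ e₁ q ⟩
    2 * (12 * (q * q)) ≤⟨ ℕₚ.*-monoʳ-≤ 2 dense ⟩
    2 * (n * (p * p))  ≡⟨ sym (ℕₚ.*-assoc 2 n (p * p)) ⟩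
    2 * n * (p * p)    ≤⟨ ℕₚ.*-monoˡ-≤ (p * p) (ℕₚ.≤-trans (ℕₚ.*-monoʳ-≤ 2 n≤choose) (2*choose-2≤square s)) ⟩
    s * s * (p * p)    ≡⟨ e₂ s p ⟩
    (s * p) * (s * p)  ≤⟨ ℕₚ.*-mono-≤ sp≤3q sp≤3q ⟩
    (3 * q) * (3 * q)  ≡⟨ e₃ q ⟩
    9 * (q * q)        ∎
    where
    e₁ : ∀ q → 24 * (q * q) ≡ 2 * (12 * (q * q))
    e₁ = solve-∀
    e₂ : ∀ s p → s * s * (p * p) ≡ (s * p) * (s * p)
    e₂ = solve-∀
    e₃ : ∀ q → (3 * q) * (3 * q) ≡ 9 * (q * q)
    e₃ = solve-∀
  9q²<24q² : 9 * (q * q) < 24 * (q * q)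
  9q²<24q² = ℕₚ.*-monoˡ-< (q * q) {{ℕₚ.m*n≢0 q q}} (ℕₚ.m<n+m 9 {15} (s≤s z≤n))

module _ {n : ℕ} (D : Digraph n) (p q : ℕ) .{{_ : NonZero p}} .{{_ : NonZero q}}
         (dense : 12 * (q * q) ≤ n * (p * p)) (δ⁺≥ : ∀ v → p * n ≤ q * outdeg D v) where

  private
    s : ℕ
    s = suc (2 * q / p)

    δ⁺≥-count : ∀ v → p * n ≤ q * count (arc D v)
    δ⁺≥-count v = subst (λ d → p * n ≤ q * d) (outdeg≡count D v) (δ⁺≥ v)

    n>0 : 0 < n
    n>0 = ℕₚ.n≢0⇒n>0 λ { refl → ℕₚ.<⇒≱ (ℕₚ.*-monoʳ-< 12 (ℕ.>-nonZero⁻¹ (q * q) {{ℕₚ.m*n≢0 q q}})) dense }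

    p≤q : p ≤ q
    p≤q = ℕₚ.*-cancelʳ-≤ p q n {{ℕ.>-nonZero n>0}} (ℕₚ.≤-trans (δ⁺≥-count v) (ℕₚ.*-monoʳ-≤ q (count≤n (arc D v))))
      where
      v = Fin.fromℕ< n>0

    2q<sp : 2 * q < s * p
    2q<sp = begin-strict
      2 * q                     ≡⟨ DivMod.m≡m%n+[m/n]*n (2 * q) p ⟩
      2 * q % p + 2 * q / p * p <⟨ ℕₚ.+-monoˡ-< (2 * q / p * p) (DivMod.m%n<n (2 * q) p) ⟩
      p + 2 * q / p * p         ∎
      where open ℕₚ.≤-Reasoning

    sp≤3q : s * p ≤ 3 * q
    sp≤3q = ℕₚ.+-mono-≤ p≤q (DivMod.m/n*n≤m (2 * q) p)

    no-far-family : (L : Fin s → Fin n) → (∀ i j → i Fin.< j → near D (L j) (L i) ≡ false) → ⊥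
    no-far-family L far = far-family-arithmetic {n} {p} {q} {s} dense (ℕₚ.<⇒≤ 2q<sp) sp≤3q (ℕₚ.≤-trans
      (overlap-bound (arc D ∘ L) {p * n} {q} (λ i j i<j → far⇒commonOut≤1 D (L j) (L i) (far i j i<j))
                     (δ⁺≥-count ∘ L))
      (ℕₚ.*-monoʳ-≤ q (ℕₚ.+-monoˡ-≤ (s choose 2) (count≤n (⋃ (arc D ∘ L))))))

  near-colourable⇒colourable : ∀ {K} → (∀ x → ColourableOn D (near D x) K) →
                               ∃ λ m → Colourable D m × m * p ≤ K * (2 * q)
  near-colourable⇒colourable {K} near-col with far-family-or-cover (near D) s
  ... | inj₁ (L , far) = ⊥-elim (no-far-family L far)
  ... | inj₂ (t , L , t<s , covers) = t * K , cover⇒colourable D (near D ∘ L) (near-col ∘ L) covers , few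
    where
    open ℕₚ.≤-Reasoning
    few : t * K * p ≤ K * (2 * q)
    few = begin
      t * K * p   ≡⟨ e t K p ⟩
      K * (t * p) ≤⟨ ℕₚ.*-monoʳ-≤ K (ℕₚ.≤-trans (ℕₚ.*-monoˡ-≤ p (ℕₚ.≤-pred t<s)) (DivMod.m/n*n≤m (2 * q) p)) ⟩
      K * (2 * q) ∎
      where
      e : ∀ t K p → t * K * p ≡ K * (t * p)
      e = solve-∀

-- Embedding the cycle

-- The image of w₁ → w₂ ← w₃ → w₄ ← w₅ with possibly w₁ = w₅: C4 and every cycle containing P5 have one.
record Zigzag {k : ℕ} (C : Digraph k) : Set where
  field
    w₁ w₂ w₃ w₄ w₅ : Fin k
    w₁→w₂ : Arc C w₁ w₂
    w₃→w₂ : Arc C w₃ w₂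
    w₃→w₄ : Arc C w₃ w₄
    w₅→w₄ : Arc C w₅ w₄
    w₁≢w₃ : w₁ ≢ w₃
    w₂≢w₄ : w₂ ≢ w₄
    w₅≢w₃ : w₅ ≢ w₃
    w₅≢w₂ : w₅ ≢ w₂

P5⇒Zigzag : ∀ {k} {C : Digraph k} → Contains C P5 → Zigzag C
P5⇒Zigzag (ψ , ψ-injective , ψ-arc) = record
  { w₁ = ψ zero ; w₂ = ψ (suc zero) ; w₃ = ψ (suc (suc zero)) ; w₄ = ψ (suc (suc (suc zero)))
  ; w₅ = ψ (suc (suc (suc (suc zero))))
  ; w₁→w₂ = ψ-arc _ _ refl ; w₃→w₂ = ψ-arc _ _ refl ; w₃→w₄ = ψ-arc _ _ refl ; w₅→w₄ = ψ-arc _ _ refl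
  ; w₁≢w₃ = λ eq → contradiction (ψ-injective _ _ eq) λ ()
  ; w₂≢w₄ = λ eq → contradiction (ψ-injective _ _ eq) λ ()
  ; w₅≢w₃ = λ eq → contradiction (ψ-injective _ _ eq) λ ()
  ; w₅≢w₂ = λ eq → contradiction (ψ-injective _ _ eq) λ ()
  }

C4-zigzag : Zigzag C4
C4-zigzag = record
  { w₁ = zero ; w₂ = suc zero ; w₃ = suc (suc zero) ; w₄ = suc (suc (suc zero)) ; w₅ = zero
  ; w₁→w₂ = refl ; w₃→w₂ = refl ; w₃→w₄ = refl ; w₅→w₄ = refl
  ; w₁≢w₃ = λ () ; w₂≢w₄ = λ () ; w₅≢w₃ = λ () ; w₅≢w₂ = λ ()
  }

module _ {k : ℕ} where

  arc? : (C : Digraph k) → ∀ u v → Dec (Arc C u v)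
  arc? C u v = arc C u v Boolₚ.≟ true

  CycSucc? : ∀ u v → Dec (CycSucc k u v)
  CycSucc? u v = (suc (toℕ u) ℕₚ.≟ toℕ v) ⊎-dec ((suc (toℕ u) ℕₚ.≟ k) ×-dec (toℕ v ℕₚ.≟ 0))

  OrientedCycle? : (C : Digraph k) → Dec (OrientedCycle k C)
  OrientedCycle? C =
          (Finₚ.all? λ u → Finₚ.all? λ v → arc? C u v →-dec ¬? (arc? C v u))
    ×-dec (Finₚ.all? λ u → Finₚ.all? λ v → (arc? C u v ⊎-dec arc? C v u) →-dec (CycSucc? u v ⊎-dec CycSucc? v u))
    ×-dec (Finₚ.all? λ u → Finₚ.all? λ v → (CycSucc? u v ⊎-dec CycSucc? v u) →-dec (arc? C u v ⊎-dec arc? C v u))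

C4-oriented-cycle : OrientedCycle 4 C4
C4-oriented-cycle = from-yes (OrientedCycle? C4)

∀⊎⇒⊎∀ : ∀ {n} {A : Fin n → Set} {B : Set} → (∀ x → A x ⊎ B) → (∀ x → A x) ⊎ B
∀⊎⇒⊎∀ {zero}  f = inj₁ λ ()
∀⊎⇒⊎∀ {suc n} f with f zero | ∀⊎⇒⊎∀ (f ∘ suc)
... | inj₂ b  | _       = inj₂ b
... | inj₁ _  | inj₂ b  = inj₂ b
... | inj₁ a₀ | inj₁ as = inj₁ λ { zero → a₀ ; (suc x) → as x }

¬CStarProperty-zero : ∀ {j} {T : Digraph j} → OrientedTree T → Fin j → ¬ CStarProperty j 0
¬CStarProperty-zero {T = T} tree a c* with c* 0 empty (λ ()) (λ _ _ → z≤n) T tree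
  where
  empty : Digraph 0
  empty = record { arc = λ () ; loopless = λ () }
... | φ , _ with φ a
... | ()

too-few-colours : ∀ c q .{{_ : NonZero q}} → ¬ (4 * suc c * q ≤ (1 + (c + c)) * (2 * q))
too-few-colours c q le = ℕₚ.m+1+n≰m (2 * (1 + (c + c))) {1}
  (subst (_≤ 2 * (1 + (c + c))) (e₂ c) (ℕₚ.*-cancelʳ-≤ (4 * suc c) _ q (subst (4 * suc c * q ≤_) (e₁ c q) le)))
  where
  e₁ : ∀ c q → (1 + (c + c)) * (2 * q) ≡ 2 * (1 + (c + c)) * q
  e₁ = solve-∀
  e₂ : ∀ c → 4 * suc c ≡ 2 * (1 + (c + c)) + 2
  e₂ = solve-∀

module _ {n j : ℕ} (D : Digraph n) {C : Digraph (suc j)} (oc : OrientedCycle (suc j) C) (Z : Zigzag C) where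

  open Zigzag Z
  open OrientedCycleNeighbours {C = C} oc

  private
    ι : Fin j → Fin (suc j)
    ι = Fin.punchIn w₃

    index : ∀ {v} → w₃ ≢ v → Fin j
    index = Fin.punchOut

    ι-index : ∀ {v} (w₃≢v : w₃ ≢ v) → ι (index w₃≢v) ≡ v
    ι-index = Finₚ.punchIn-punchOut

    ι≡⇒≡index : ∀ {a v} (w₃≢v : w₃ ≢ v) → ι a ≡ v → a ≡ index w₃≢v
    ι≡⇒≡index w₃≢v ιa≡v = Finₚ.punchIn-injective w₃ _ _ (trans ιa≡v (sym (ι-index w₃≢v)))

    index-injective : ∀ {v v′} (w₃≢v : w₃ ≢ v) (w₃≢v′ : w₃ ≢ v′) → v ≢ v′ → index w₃≢v ≢ index w₃≢v′
    index-injective w₃≢v w₃≢v′ v≢v′ eq =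
      v≢v′ (trans (sym (ι-index w₃≢v)) (trans (cong ι eq) (ι-index w₃≢v′)))

    a₂ a₄ : Fin j
    a₂ = index (Arc⇒≢ C w₃→w₂)
    a₄ = index (Arc⇒≢ C w₃→w₄)

    w₃-no-in : ∀ {u} → ¬ Arc C u w₃
    w₃-no-in = source-in w₂≢w₄ w₃→w₂ w₃→w₄

  extend-from-out-neighbourhood : ∀ x {φ} → IsEmbedding (C ─ w₃) D φ → (∀ a → Arc D x (φ a)) → Contains D C
  extend-from-out-neighbourhood x φ-embedding x→φ =
    extend C w₃ φ-embedding x (λ a → Arc⇒≢ D (x→φ a) ∘ sym) (λ a _ → x→φ a) (λ _ → ⊥-elim ∘ w₃-no-in)

  -- w₂ and w₄ are moved to common out-neighbours y ≠ y′ of x with φ w₁ and φ w₅, then w₃ is sent to x.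
  module _ (x : Fin n) {φ : Fin j → Fin n} (φ-embedding : IsEmbedding (C ─ w₃) D φ)
           (φ∈wedge : ∀ a → wedge D x (φ a) ≡ true) where

    private
      a₁ a₅ : Fin j
      a₁ = index (w₁≢w₃ ∘ sym)
      a₅ = index (w₅≢w₃ ∘ sym)

      out∉wedge : ∀ {v} → Arc D x v → wedge D x v ≢ true
      out∉wedge x→v v∈wedge = proj₁ (proj₂ (wedge-spec D x _ v∈wedge)) x→v

      y-spec : ∃ λ y → arc D (φ a₁) y ∧ arc D x y ≡ true
      y-spec = count>0⇒∃ _ (ℕₚ.<-trans (s≤s z≤n) (proj₂ (proj₂ (wedge-spec D x (φ a₁) (φ∈wedge a₁)))))

      y : Fin n
      y = proj₁ y-spec

      y′-spec : ∃ λ y′ → y′ ≢ y × arc D (φ a₅) y′ ∧ arc D x y′ ≡ true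
      y′-spec = count>1⇒∃≢ _ (proj₂ (proj₂ (wedge-spec D x (φ a₅) (φ∈wedge a₅)))) y

      y′ : Fin n
      y′ = proj₁ y′-spec

      x→y : Arc D x y
      x→y = proj₂ (∧-true (proj₂ y-spec))

      x→y′ : Arc D x y′
      x→y′ = proj₂ (∧-true (proj₂ (proj₂ y′-spec)))

      φ₁ : Fin j → Fin n
      φ₁ = updateAt φ a₂ (const y)

      φ₁-embedding : IsEmbedding (C ─ w₃) D φ₁
      φ₁-embedding = updateAt-embedding φ-embedding a₂ y
        (λ b _ φb≡y → out∉wedge (subst (Arc D x) (sym φb≡y) x→y) (φ∈wedge b))
        (λ b a₂→b → ⊥-elim
          (sink-out w₁≢w₃ w₁→w₂ w₃→w₂ (subst (λ v → Arc C v (ι b)) (ι-index _) a₂→b)))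
        into-a₂
        where
        into-a₂ : ∀ b → Arc (C ─ w₃) b a₂ → Arc D (φ b) y
        into-a₂ b b→a₂ with sink-in w₁≢w₃ w₁→w₂ w₃→w₂ (subst (Arc C (ι b)) (ι-index _) b→a₂)
        ... | inj₁ ιb≡w₁ =
          subst (λ a → Arc D (φ a) y) (sym (ι≡⇒≡index _ ιb≡w₁)) (proj₁ (∧-true (proj₂ y-spec)))
        ... | inj₂ ιb≡w₃ = ⊥-elim (Finₚ.punchInᵢ≢i w₃ b ιb≡w₃)

      φ₁-image : ∀ b → φ₁ b ≡ y ⊎ wedge D x (φ₁ b) ≡ true
      φ₁-image = updateAt-preserves (λ v → v ≡ y ⊎ wedge D x v ≡ true) a₂ (inj₂ ∘ φ∈wedge) (inj₁ refl)

      φ₂ : Fin j → Fin n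
      φ₂ = updateAt φ₁ a₄ (const y′)

      φ₂-embedding : IsEmbedding (C ─ w₃) D φ₂
      φ₂-embedding = updateAt-embedding φ₁-embedding a₄ y′ y′-new
        (λ b a₄→b → ⊥-elim
          (sink-out (w₅≢w₃ ∘ sym) w₃→w₄ w₅→w₄ (subst (λ v → Arc C v (ι b)) (ι-index _) a₄→b)))
        into-a₄
        where
        y′-new : ∀ b → b ≢ a₄ → φ₁ b ≢ y′
        y′-new b _ φ₁b≡y′ with φ₁-image b
        ... | inj₁ φ₁b≡y       = proj₁ (proj₂ y′-spec) (trans (sym φ₁b≡y′) φ₁b≡y)
        ... | inj₂ φ₁b∈wedge = out∉wedge (subst (Arc D x) (sym φ₁b≡y′) x→y′) φ₁b∈wedge
        into-a₄ : ∀ b → Arc (C ─ w₃) b a₄ → Arc D (φ₁ b) y′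
        into-a₄ b b→a₄ with sink-in (w₅≢w₃ ∘ sym) w₃→w₄ w₅→w₄ (subst (Arc C (ι b)) (ι-index _) b→a₄)
        ... | inj₁ ιb≡w₃ = ⊥-elim (Finₚ.punchInᵢ≢i w₃ b ιb≡w₃)
        ... | inj₂ ιb≡w₅ rewrite ι≡⇒≡index _ ιb≡w₅ =
          subst (λ v → Arc D v y′) (sym (updateAt-minimal a₅ a₂ φ (index-injective _ _ w₅≢w₂)))
                (proj₁ (∧-true (proj₂ (proj₂ y′-spec))))

      φ₂-image : ∀ b → Arc D x (φ₂ b) ⊎ wedge D x (φ₂ b) ≡ true
      φ₂-image = updateAt-preserves (λ v → Arc D x v ⊎ wedge D x v ≡ true) a₄
        (Sum.map₁ (λ φ₁b≡y → subst (Arc D x) (sym φ₁b≡y) x→y) ∘ φ₁-image) (inj₁ x→y′)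

      x-new : ∀ b → φ₂ b ≢ x
      x-new b φ₂b≡x with φ₂-image b
      ... | inj₁ x→φ₂b     = Arc⇒≢ D x→φ₂b (sym φ₂b≡x)
      ... | inj₂ φ₂b∈wedge = proj₁ (wedge-spec D x _ φ₂b∈wedge) φ₂b≡x

      x-out : ∀ b → Arc C w₃ (ι b) → Arc D x (φ₂ b)
      x-out b w₃→ιb with source-out w₂≢w₄ w₃→w₂ w₃→w₄ w₃→ιb
      ... | inj₁ ιb≡w₂ rewrite ι≡⇒≡index _ ιb≡w₂ = subst (Arc D x)
        (sym (trans (updateAt-minimal a₂ a₄ φ₁ (index-injective _ _ w₂≢w₄)) (updateAt-updates a₂ φ))) x→y
      ... | inj₂ ιb≡w₄ rewrite ι≡⇒≡index _ ιb≡w₄ = subst (Arc D x) (sym (updateAt-updates a₄ φ₁)) x→y′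

    extend-from-wedge : Contains D C
    extend-from-wedge = extend C w₃ φ₂-embedding x x-new x-out (λ _ → ⊥-elim ∘ w₃-no-in)

  c*-embedding : ∀ {c} (S : Fin n → Bool) → CStarProperty j c → ChiAtLeastℕ (induced D S) c →
                 ∃ λ φ → IsEmbedding (C ─ w₃) D φ × (∀ a → S (φ a) ≡ true)
  c*-embedding S c* χ≥c = induced-embedding D S {H = C ─ w₃} (contains-orient (induced D S) {H = C ─ w₃}
    (c* _ (orient (induced D S)) (orient-oriented (induced D S)) (χ≥-orient (induced D S) χ≥c)
        (C ─ w₃) (cycle─vertex-tree C oc w₃)))

  local-dichotomy : ∀ {c} → CStarProperty j (suc c) → ∀ x →
    (Colourable (induced D (arc D x)) c × Colourable (induced D (wedge D x)) c) ⊎ Contains D C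
  local-dichotomy {c} c* x with colourable⊎χ≥ (induced D (arc D x)) c | colourable⊎χ≥ (induced D (wedge D x)) c
  ... | inj₂ χ≥ | _ =
    let (_ , φ-embedding , x→φ) = c*-embedding (arc D x) c* χ≥ in
    inj₂ (extend-from-out-neighbourhood x φ-embedding x→φ)
  ... | inj₁ _ | inj₂ χ≥ =
    let (_ , φ-embedding , φ∈wedge) = c*-embedding (wedge D x) c* χ≥ in
    inj₂ (extend-from-wedge x φ-embedding φ∈wedge)
  ... | inj₁ out-colourable | inj₁ wedge-colourable = inj₁ (out-colourable , wedge-colourable)

  zigzag-cycle-embeds : ∀ {c} → CStarProperty j c → (p q : ℕ) .{{_ : NonZero p}} .{{_ : NonZero q}} →
                        12 * (q * q) ≤ n * (p * p) → (∀ v → p * n ≤ q * outdeg D v) →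
                        (∀ m → Colourable D m → 4 * c * q ≤ m * p) → Contains D C
  zigzag-cycle-embeds {zero} c* _ _ _ _ _ = ⊥-elim (¬CStarProperty-zero (cycle─vertex-tree C oc w₃) a₂ c*)
  zigzag-cycle-embeds {suc c} c* p q dense δ⁺≥ χ≥ with ∀⊎⇒⊎∀ (local-dichotomy c*)
  ... | inj₂ D⊇C = D⊇C
  ... | inj₁ local
    with near-colourable⇒colourable D p q dense δ⁺≥ (λ x → near-colourable D x (proj₁ (local x)) (proj₂ (local x)))
  ...   | m , m-colourable , mp≤ = ⊥-elim (too-few-colours c q (ℕₚ.≤-trans (χ≥ m m-colourable) mp≤))

-- Clearing denominators

-- ε = (1 + p) / (1 + q)
module ClearDenominators (p q : ℕ) .(coprime : Coprime (suc p) (suc q)) where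

  open import Data.Integer using (+_)

  private
    ε : ℚ
    ε = mkℚ +[1+ p ] q coprime

    1/ε : ℚᵘ
    1/ε = mkℚᵘ +[1+ q ] p

    ≤ᵘ⇒cross : ∀ {x y : ℚᵘ} {a c : ℕ} → x ≤ᵘ y → ℚᵘ.↥ x ≡ + a → ℚᵘ.↥ y ≡ + c →
               a * ℚᵘ.↧ₙ y ≤ c * ℚᵘ.↧ₙ x
    ≤ᵘ⇒cross {x@record{}} {y@record{}} {a} {c} (*≤* x≤y) refl refl =
      ℤₚ.drop‿+≤+ (subst₂ ℤ._≤_ (sym (ℤₚ.pos-* a (ℚᵘ.↧ₙ y))) (sym (ℤₚ.pos-* c (ℚᵘ.↧ₙ x))) x≤y)

    toℚᵘ-ℕ→ℚ : ∀ m → toℚᵘ (ℕ→ℚ m) ≃ᵘ mkℚᵘ (+ m) 0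
    toℚᵘ-ℕ→ℚ m = ℚₚ.toℚᵘ-fromℚᵘ (mkℚᵘ (+ m) 0)

    toℚᵘ-÷ : ∀ x → toℚᵘ (x ÷ ε) ≃ᵘ toℚᵘ x ℚᵘ.* 1/ε
    toℚᵘ-÷ x = ℚₚ.toℚᵘ-homo-* x (1/ ε)

  12/ε²≤n⇒ : ∀ n → (ℕ→ℚ 12 ÷⁺ ε) ÷⁺ ε ≤ℚ ℕ→ℚ n → 12 * (suc q * suc q) ≤ n * (suc p * suc p)
  12/ε²≤n⇒ n le = subst₂ _≤_ (e₁ q) (e₂ n p) (≤ᵘ⇒cross le′ refl refl)
    where
    e₁ : ∀ q → 12 * suc q * suc q * 1 ≡ 12 * (suc q * suc q)
    e₁ = solve-∀
    e₂ : ∀ n p → n * (1 * suc p * suc p) ≡ n * (suc p * suc p)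
    e₂ = solve-∀
    lhs : toℚᵘ ((ℕ→ℚ 12 ÷⁺ ε) ÷⁺ ε) ≃ᵘ (mkℚᵘ (+ 12) 0 ℚᵘ.* 1/ε) ℚᵘ.* 1/ε
    lhs = begin
      toℚᵘ ((ℕ→ℚ 12 ÷⁺ ε) ÷⁺ ε)        ≈⟨ toℚᵘ-÷ (ℕ→ℚ 12 ÷⁺ ε) ⟩
      toℚᵘ (ℕ→ℚ 12 ÷⁺ ε) ℚᵘ.* 1/ε       ≈⟨ ℚᵘₚ.*-congʳ {1/ε} (toℚᵘ-÷ (ℕ→ℚ 12)) ⟩
      (toℚᵘ (ℕ→ℚ 12) ℚᵘ.* 1/ε) ℚᵘ.* 1/ε ≈⟨ ℚᵘₚ.*-congʳ {1/ε} (ℚᵘₚ.*-congʳ {1/ε} (toℚᵘ-ℕ→ℚ 12)) ⟩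
      (mkℚᵘ (+ 12) 0 ℚᵘ.* 1/ε) ℚᵘ.* 1/ε ∎
      where open ℚᵘₚ.≃-Reasoning
    le′ : (mkℚᵘ (+ 12) 0 ℚᵘ.* 1/ε) ℚᵘ.* 1/ε ≤ᵘ mkℚᵘ (+ n) 0
    le′ = ℚᵘₚ.≤-respʳ-≃ (toℚᵘ-ℕ→ℚ n) (ℚᵘₚ.≤-respˡ-≃ lhs (ℚₚ.toℚᵘ-mono-≤ le))

  εn≤d⇒ : ∀ n d → ε *ℚ ℕ→ℚ n ≤ℚ ℕ→ℚ d → suc p * n ≤ suc q * d
  εn≤d⇒ n d le = subst₂ _≤_ (ℕₚ.*-identityʳ (suc p * n)) (e d q)
                   (≤ᵘ⇒cross le′ (sym (ℤₚ.pos-* (suc p) n)) refl)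
    where
    e : ∀ d q → d * (suc q * 1) ≡ suc q * d
    e = solve-∀
    lhs : toℚᵘ (ε *ℚ ℕ→ℚ n) ≃ᵘ mkℚᵘ +[1+ p ] q ℚᵘ.* mkℚᵘ (+ n) 0
    lhs = ℚᵘₚ.≃-trans (ℚₚ.toℚᵘ-homo-* ε (ℕ→ℚ n)) (ℚᵘₚ.*-congˡ {mkℚᵘ +[1+ p ] q} (toℚᵘ-ℕ→ℚ n))
    le′ : mkℚᵘ +[1+ p ] q ℚᵘ.* mkℚᵘ (+ n) 0 ≤ᵘ mkℚᵘ (+ d) 0
    le′ = ℚᵘₚ.≤-respʳ-≃ (toℚᵘ-ℕ→ℚ d) (ℚᵘₚ.≤-respˡ-≃ lhs (ℚₚ.toℚᵘ-mono-≤ le))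

  c/ε≤m⇒ : ∀ c m → ℕ→ℚ c ÷⁺ ε ≤ℚ ℕ→ℚ m → c * suc q ≤ m * suc p
  c/ε≤m⇒ c m le = subst₂ _≤_ (ℕₚ.*-identityʳ (c * suc q)) (cong (m *_) (ℕₚ.*-identityˡ (suc p)))
                    (≤ᵘ⇒cross le′ (sym (ℤₚ.pos-* c (suc q))) refl)
    where
    lhs : toℚᵘ (ℕ→ℚ c ÷⁺ ε) ≃ᵘ mkℚᵘ (+ c) 0 ℚᵘ.* 1/ε
    lhs = ℚᵘₚ.≃-trans (toℚᵘ-÷ (ℕ→ℚ c)) (ℚᵘₚ.*-congʳ {1/ε} (toℚᵘ-ℕ→ℚ c))
    le′ : mkℚᵘ (+ c) 0 ℚᵘ.* 1/ε ≤ᵘ mkℚᵘ (+ m) 0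
    le′ = ℚᵘₚ.≤-respʳ-≃ (toℚᵘ-ℕ→ℚ m) (ℚᵘₚ.≤-respˡ-≃ lhs (ℚₚ.toℚᵘ-mono-≤ le))

lemma2p1 : (ε : ℚ) → .{{_ : Positive ε}} → (k : ℕ) → 4 ≤ k →
    (c : ℕ) → IsCStar (k ∸ 1) c →
    (n : ℕ) → (D : Digraph n) →
    (ℕ→ℚ 12 ÷⁺ ε) ÷⁺ ε ≤ℚ ℕ→ℚ n →
    ChiAtLeast D (ℕ→ℚ (4 * c) ÷⁺ ε) →
    (∀ v → ε *ℚ ℕ→ℚ n ≤ℚ ℕ→ℚ (outdeg D v)) →
    (k ≡ 4 → Contains D C4)
    × (5 ≤ k → (C : Digraph k) → OrientedCycle k C → Contains C P5 → Contains D C)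
lemma2p1 (mkℚ +[1+ p ] q coprime) (suc j) _ c (c* , _) n D 12/ε²≤n χ≥4c/ε δ⁺≥εn = C4-case , long-case
  where
  open ClearDenominators p q coprime

  embeds : (C : Digraph (suc j)) → OrientedCycle (suc j) C → Zigzag C → Contains D C
  embeds C oc Z = zigzag-cycle-embeds D oc Z c* (suc p) (suc q)
    (12/ε²≤n⇒ n 12/ε²≤n)
    (λ v → εn≤d⇒ n (outdeg D v) (δ⁺≥εn v))
    (λ m → c/ε≤m⇒ (4 * c) m ∘ χ≥4c/ε m)

  C4-case : suc j ≡ 4 → Contains D C4
  C4-case refl = embeds C4 C4-oriented-cycle C4-zigzag

  long-case : 5 ≤ suc j → (C : Digraph (suc j)) → OrientedCycle (suc j) C → Contains C P5 → Contains D C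
  long-case _ C oc C⊇P5 = embeds C oc (P5⇒Zigzag C⊇P5)
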